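{- Let $\mathbb{F}_q$ be a finite field, $\mathcal{V}$ a vector space over $\mathbb{F}_q$, and $k,t$ integers with $0\le t\le k$. Let $n\ge 2$ and let $\mathcal{C}=\{\pi_1,\ldots,\pi_n\}$ be a $(k,k-t)$-SCID in $\mathcal{V}$. Define $S:=\langle \pi_1,\ldots,\pi_n\rangle$ and $I:=\langle \pi_i\cap\pi_j \mid 1\le i<j\le n\rangle$. Then \[\dim S+\dim I\le nk.\]
   Context: A $(k,k-t)$-SCID is a set of (distinct) $k$-dimensional subspaces of $\mathcal{V}$, containing at least two elements, such that any two distinct members intersect in a subspace of dimension exactly $k-t$. $\langle\cdot\rangle$ denotes the span. -}

module Defs where

open import Level using (Level; _⊔_)
open import Data.Nat using (ℕ; zero; suc)
open import Data.Fin using (Fin; zero; suc)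
open import Data.Product using (Σ; ∃; _×_; _,_)
open import Relation.Nullary using (¬_)
open import Relation.Binary.PropositionalEquality using (_≡_; _≢_)
open import Relation.Unary using (Pred)
open import Function using (Surjective)
open import Algebra.Bundles using (CommutativeRing)
open import Algebra.Module.Bundles using (Module)

record IsField {c ℓ : Level} (R : CommutativeRing c ℓ) : Set (c ⊔ ℓ) where
  open CommutativeRing R
  field
    0≉1     : ¬ (0# ≈ 1#)
    inverse : ∀ x → ¬ (x ≈ 0#) → Σ Carrier (λ y → (x * y) ≈ 1#)

record IsFiniteField {c ℓ : Level} (R : CommutativeRing c ℓ) : Set (c ⊔ ℓ) where
  open CommutativeRing R
  field
    isField : IsField R
    q       : ℕ
    enum    : Fin q → Carrier
    enum-surjective : ∀ x → Σ (Fin q) (λ i → enum i ≈ x)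

module LinearAlgebra {c ℓ m ℓm : Level} {R : CommutativeRing c ℓ} (V : Module R m ℓm) where
  open CommutativeRing R using (Carrier; 0#) renaming (_≈_ to _≈F_)
  open Module V

  Subset : Set (Level.suc (c ⊔ ℓ ⊔ m ⊔ ℓm))
  Subset = Pred Carrierᴹ (c ⊔ ℓ ⊔ m ⊔ ℓm)

  lincomb : ∀ {d} → (Fin d → Carrier) → (Fin d → Carrierᴹ) → Carrierᴹ
  lincomb {zero}  a v = 0ᴹ
  lincomb {suc d} a v = (a zero *ₗ v zero) +ᴹ lincomb (λ i → a (suc i)) (λ i → v (suc i))

  IsSubspace : Subset → Set (c ⊔ ℓ ⊔ m ⊔ ℓm)
  IsSubspace U =
    (∀ {x y} → x ≈ᴹ y → U x → U y) ×
    U 0ᴹ ×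
    (∀ {x y} → U x → U y → U (x +ᴹ y)) ×
    (∀ a {x} → U x → U (a *ₗ x))

  _∩_ : Subset → Subset → Subset
  (U ∩ W) x = U x × W x

  _⊆_ : Subset → Subset → Set (c ⊔ ℓ ⊔ m ⊔ ℓm)
  U ⊆ W = ∀ {x} → U x → W x

  _≐_ : Subset → Subset → Set (c ⊔ ℓ ⊔ m ⊔ ℓm)
  U ≐ W = (U ⊆ W) × (W ⊆ U)

  LinearlyIndependent : ∀ {d} → (Fin d → Carrierᴹ) → Set (c ⊔ ℓ ⊔ ℓm)
  LinearlyIndependent {d} b = ∀ (a : Fin d → Carrier) → lincomb a b ≈ᴹ 0ᴹ → ∀ i → a i ≈F 0#

  HasDim : Subset → ℕ → Set (c ⊔ ℓ ⊔ m ⊔ ℓm)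
  HasDim U d = Σ (Fin d → Carrierᴹ) λ b →
    (∀ i → U (b i)) × LinearlyIndependent b ×
    (∀ {x} → U x → Σ (Fin d → Carrier) λ a → x ≈ᴹ lincomb a b)

  SpanOf : {A : Set} → (A → Subset) → Subset
  SpanOf {A} U x = Σ ℕ λ d → Σ (Fin d → Carrier) λ a → Σ (Fin d → Carrierᴹ) λ w →
    (∀ l → Σ A λ i → U i (w l)) × (x ≈ᴹ lincomb a w)

  record IsSCID (k t n : ℕ) (π : Fin n → Subset) : Set (c ⊔ ℓ ⊔ m ⊔ ℓm) where
    field
      subspace  : ∀ i → IsSubspace (π i)
      dim-k     : ∀ i → HasDim (π i) k
      distinct  : ∀ i j → i ≢ j → ¬ (π i ≐ π j)
      intersect : ∀ i j → i ≢ j → HasDim (π i ∩ π j) (k Data.Nat.∸ t)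

module Submission where

-- Treat π_0, …, π_(n-1) one at a time, keeping lists A and B of vectors with
-- π_i ⊆ ⟨A⟩ and π_i ∩ π_i' ⊆ ⟨B⟩ for i < i' < j, and |A| + |B| ≤ jk. For π_j take a
-- basis D of ⟨A⟩ ∩ π_j, extend it by E to a basis of π_j, and append E to A and D
-- to B; this adds |E| + |D| = k. Finally S ⊆ ⟨A⟩ and I ⊆ ⟨B⟩, so the Steinitz
-- exchange lemma gives dim S + dim I ≤ |A| + |B| ≤ nk. Neither equality in F nor
-- membership in a span is decidable, so the choices are made in the double-negation
-- monad; this is harmless because the goal, an inequality of naturals, is ¬¬-stable.

open import Defs
open import Level using (Level)
open import Data.Nat using (ℕ; _≤_; _*_; _+_; _<_)
open import Data.Fin using (Fin) renaming (_<_ to _<ᶠ_)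
open import Data.Product using (Σ; _×_; _,_; proj₁; proj₂)
open import Algebra.Bundles using (CommutativeRing)
open import Algebra.Module.Bundles using (Module)

open import Level using (_⊔_)
open import Algebra.Bundles using (CommutativeMonoid)
import Algebra.Properties.CommutativeSemigroup as CommutativeSemigroupProperties
open import Data.Empty using (⊥-elim)
open import Function using (_∘_)
open import Data.Sum using (_⊎_; inj₁; inj₂)
open import Data.Nat using (zero; suc; z≤n; s≤s; _∸_; _⊓_)
import Data.Nat.Properties as ℕ
open import Data.Fin using (zero; suc; toℕ; fromℕ<)
open import Data.Fin.Properties using (toℕ-injective; toℕ-fromℕ<; toℕ<n)
open import Data.List using (List; []; _∷_; _++_; length; map; replicate; tabulate; take; drop)
import Data.List.Properties as List
open import Data.List.Membership.Propositional using (_∈_; find)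
open import Data.List.Membership.Propositional.Properties using (∈-∃++; ∈-++⁺ˡ; ∈-++⁺ʳ)
open import Data.List.Relation.Unary.All as All using (All; []; _∷_)
import Data.List.Relation.Unary.All.Properties as All
open import Data.List.Relation.Unary.Any using (here; there)
open import Data.List.Relation.Binary.Pointwise using (Pointwise; []; _∷_)
open import Data.List.Relation.Binary.Pointwise.Properties using (Pointwise-length)
open import Relation.Nullary using (¬_; yes; no)
open import Relation.Nullary.Decidable using (decidable-stable; ¬¬-excluded-middle)
open import Relation.Nullary.Negation using (¬¬-map)
open import Relation.Unary using (Pred; _⊆_; _∩_)
open import Relation.Binary.PropositionalEquality
  using (_≡_; refl; sym; trans; cong; cong₂; subst)

private variable
  a b ℓ′ : Level
  X : Set a
  Y : Set b

return : X → ¬ ¬ X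
return x ¬x = ¬x x

_>>=_ : ¬ ¬ X → (X → ¬ ¬ Y) → ¬ ¬ Y
(¬¬x >>= f) ¬y = ¬¬x λ x → f x ¬y

≤-stable : ∀ {m n} → ¬ ¬ (m ≤ n) → m ≤ n
≤-stable = decidable-stable (_ ℕ.≤? _)

¬¬-All : {P : Pred X ℓ′} {xs : List X} → All (λ x → ¬ ¬ P x) xs → ¬ ¬ All P xs
¬¬-All []           = return []
¬¬-All (¬¬px ∷ ¬¬pxs) = do
  px ← ¬¬px
  pxs ← ¬¬-All ¬¬pxs
  return (px ∷ pxs)

¬¬-All-or-counterexample : {P : Pred X ℓ′} (xs : List X) →
  ¬ ¬ (All P xs ⊎ Σ (List X × X × List X) λ (pre , y , post) → xs ≡ pre ++ y ∷ post × ¬ P y)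
¬¬-All-or-counterexample {P = P} xs = ¬¬-excluded-middle >>= λ where
  (yes ∃¬P) → let y , y∈xs , ¬Py = find ∃¬P ; pre , post , xs≡ = ∈-∃++ y∈xs in
              return (inj₂ ((pre , y , post) , xs≡ , ¬Py))
  (no ∄¬P)  → ¬¬-map inj₁ (¬¬-All (All.¬Any⇒All¬ xs ∄¬P))

Pointwise-map : {R : Y → Y → Set ℓ′} (f g : X → Y) → ∀ {xs} →
  All (λ x → R (f x) (g x)) xs → Pointwise R (map f xs) (map g xs)
Pointwise-map f g []           = []
Pointwise-map f g (fx∼gx ∷ ps) = fx∼gx ∷ Pointwise-map f g ps

take-drop-length : ∀ m {n} (ys : List X) → length ys ≡ m + n →
  length (take m ys) ≡ m × length (drop m ys) ≡ n
take-drop-length m {n} ys |ys| =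
  trans (List.length-take m ys) (trans (cong (m ⊓_) |ys|) (ℕ.m≤n⇒m⊓n≡m (ℕ.m≤m+n m n))) ,
  trans (List.length-drop m ys) (trans (cong (_∸ m) |ys|) (ℕ.m+n∸m≡n m n))

module LinearCombinations {c ℓ m ℓm} {F : CommutativeRing c ℓ} (M : Module F m ℓm) where

  open CommutativeRing F using (0#; 1#) renaming (Carrier to K; _+_ to _+ᶠ_; _*_ to _*ᶠ_)
  open Module M renaming (Carrierᴹ to V)
  open CommutativeSemigroupProperties (CommutativeMonoid.commutativeSemigroup +ᴹ-commutativeMonoid)
    using (interchange)
  open import Relation.Binary.Reasoning.Setoid ≈ᴹ-setoid

  linComb : List K → List V → V
  linComb []       _        = 0ᴹ
  linComb (_ ∷ _)  []       = 0ᴹ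
  linComb (a ∷ as) (v ∷ vs) = a *ₗ v +ᴹ linComb as vs

  head₀ : List K → K
  head₀ []      = 0#
  head₀ (a ∷ _) = a

  tail₀ : List K → List K
  tail₀ []       = []
  tail₀ (_ ∷ as) = as

  infixl 6 _⊕_
  _⊕_ : List K → List K → List K
  []       ⊕ bs       = bs
  (a ∷ as) ⊕ []       = a ∷ as
  (a ∷ as) ⊕ (b ∷ bs) = a +ᶠ b ∷ as ⊕ bs

  dot : List K → List K → K
  dot []       _        = 0#
  dot (_ ∷ _)  []       = 0#
  dot (a ∷ as) (b ∷ bs) = a *ᶠ b +ᶠ dot as bs

  linComb-[]ʳ : ∀ as → linComb as [] ≈ᴹ 0ᴹ
  linComb-[]ʳ []      = ≈ᴹ-refl
  linComb-[]ʳ (_ ∷ _) = ≈ᴹ-refl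

  linComb-∷ : ∀ as w ws → linComb as (w ∷ ws) ≈ᴹ head₀ as *ₗ w +ᴹ linComb (tail₀ as) ws
  linComb-∷ []      w ws = ≈ᴹ-sym (≈ᴹ-trans (+ᴹ-identityʳ _) (*ₗ-zeroˡ w))
  linComb-∷ (_ ∷ _) w ws = ≈ᴹ-refl

  linComb-cong : ∀ as {xs ys} → Pointwise _≈ᴹ_ xs ys → linComb as xs ≈ᴹ linComb as ys
  linComb-cong []       _           = ≈ᴹ-refl
  linComb-cong (_ ∷ _)  []          = ≈ᴹ-refl
  linComb-cong (a ∷ as) (x≈y ∷ xs≈ys) = +ᴹ-cong (*ₗ-congˡ x≈y) (linComb-cong as xs≈ys)

  linComb-⊕ : ∀ as bs ws → linComb (as ⊕ bs) ws ≈ᴹ linComb as ws +ᴹ linComb bs ws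
  linComb-⊕ []       bs       ws       = ≈ᴹ-sym (+ᴹ-identityˡ _)
  linComb-⊕ (a ∷ as) []       ws       = ≈ᴹ-sym (+ᴹ-identityʳ _)
  linComb-⊕ (a ∷ as) (b ∷ bs) []       = ≈ᴹ-sym (+ᴹ-identityˡ 0ᴹ)
  linComb-⊕ (a ∷ as) (b ∷ bs) (w ∷ ws) =
    ≈ᴹ-trans (+ᴹ-cong (*ₗ-distribʳ w a b) (linComb-⊕ as bs ws)) (interchange _ _ _ _)

  linComb-scale : ∀ a as ws → linComb (map (a *ᶠ_) as) ws ≈ᴹ a *ₗ linComb as ws
  linComb-scale a []       ws       = ≈ᴹ-sym (*ₗ-zeroʳ a)
  linComb-scale a (_ ∷ _)  []       = ≈ᴹ-sym (*ₗ-zeroʳ a)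
  linComb-scale a (b ∷ bs) (w ∷ ws) =
    ≈ᴹ-trans (+ᴹ-cong (*ₗ-assoc a b w) (linComb-scale a bs ws)) (≈ᴹ-sym (*ₗ-distribˡ a _ _))

  linComb-zeros : ∀ n ws → linComb (replicate n 0#) ws ≈ᴹ 0ᴹ
  linComb-zeros zero    ws       = ≈ᴹ-refl
  linComb-zeros (suc n) []       = ≈ᴹ-refl
  linComb-zeros (suc n) (w ∷ ws) =
    ≈ᴹ-trans (+ᴹ-cong (*ₗ-zeroˡ w) (linComb-zeros n ws)) (+ᴹ-identityˡ 0ᴹ)

  linComb-++ : ∀ as bs xs ys → length as ≡ length xs →
    linComb (as ++ bs) (xs ++ ys) ≈ᴹ linComb as xs +ᴹ linComb bs ys
  linComb-++ []       bs []       ys _     = ≈ᴹ-sym (+ᴹ-identityˡ _)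
  linComb-++ (a ∷ as) bs (x ∷ xs) ys |as| =
    ≈ᴹ-trans (+ᴹ-congˡ (linComb-++ as bs xs ys (ℕ.suc-injective |as|))) (≈ᴹ-sym (+ᴹ-assoc _ _ _))

  linComb-shear : (f : X → V) (g : X → K) (y : V) → ∀ as xs →
    linComb as (map (λ x → f x +ᴹ g x *ₗ y) xs) ≈ᴹ linComb as (map f xs) +ᴹ dot as (map g xs) *ₗ y
  linComb-shear f g y []       xs       = ≈ᴹ-sym (≈ᴹ-trans (+ᴹ-congˡ (*ₗ-zeroˡ y)) (+ᴹ-identityˡ 0ᴹ))
  linComb-shear f g y (_ ∷ _)  []       = ≈ᴹ-sym (≈ᴹ-trans (+ᴹ-congˡ (*ₗ-zeroˡ y)) (+ᴹ-identityˡ 0ᴹ))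
  linComb-shear f g y (a ∷ as) (x ∷ xs) = begin
    a *ₗ (f x +ᴹ g x *ₗ y) +ᴹ linComb as (map (λ x → f x +ᴹ g x *ₗ y) xs)
      ≈⟨ +ᴹ-cong (*ₗ-distribˡ a _ _) (linComb-shear f g y as xs) ⟩
    (a *ₗ f x +ᴹ a *ₗ g x *ₗ y) +ᴹ (linComb as (map f xs) +ᴹ dot as (map g xs) *ₗ y)
      ≈⟨ interchange _ _ _ _ ⟩
    (a *ₗ f x +ᴹ linComb as (map f xs)) +ᴹ (a *ₗ g x *ₗ y +ᴹ dot as (map g xs) *ₗ y)
      ≈⟨ +ᴹ-congˡ (+ᴹ-congʳ (≈ᴹ-sym (*ₗ-assoc a (g x) y))) ⟩
    (a *ₗ f x +ᴹ linComb as (map f xs)) +ᴹ ((a *ᶠ g x) *ₗ y +ᴹ dot as (map g xs) *ₗ y)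
      ≈⟨ +ᴹ-congˡ (≈ᴹ-sym (*ₗ-distribʳ y _ _)) ⟩
    (a *ₗ f x +ᴹ linComb as (map f xs)) +ᴹ (a *ᶠ g x +ᶠ dot as (map g xs)) *ₗ y ∎

  Span : List V → Pred V (c ⊔ ℓm)
  Span ws x = Σ (List K) λ as → x ≈ᴹ linComb as ws

  Span-∈ : ∀ {x ws} → x ∈ ws → Span ws x
  Span-∈ {x} (here refl) = 1# ∷ [] , ≈ᴹ-sym (≈ᴹ-trans (+ᴹ-identityʳ _) (*ₗ-identityˡ x))
  Span-∈ {ws = w ∷ _} (there x∈ws) =
    let as , x≈ = Span-∈ x∈ws in
    0# ∷ as , ≈ᴹ-trans x≈ (≈ᴹ-sym (≈ᴹ-trans (+ᴹ-congʳ (*ₗ-zeroˡ w)) (+ᴹ-identityˡ _)))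

  ⟨_⟩ : List V → Pred V (c ⊔ ℓm)
  ⟨ ws ⟩ x = ¬ ¬ Span ws x

  ⟨⟩-resp : ∀ ws {x y} → x ≈ᴹ y → ⟨ ws ⟩ x → ⟨ ws ⟩ y
  ⟨⟩-resp ws x≈y = ¬¬-map λ (as , x≈) → as , ≈ᴹ-trans (≈ᴹ-sym x≈y) x≈

  linComb∈⟨⟩ : ∀ hs as ws → All ⟨ hs ⟩ ws → ⟨ hs ⟩ (linComb as ws)
  linComb∈⟨⟩ hs []       ws       _            = return ([] , ≈ᴹ-refl)
  linComb∈⟨⟩ hs (_ ∷ _)  []       _            = return ([] , ≈ᴹ-refl)
  linComb∈⟨⟩ hs (a ∷ as) (w ∷ ws) (w∈ ∷ ws∈) = do
    bs , w≈ ← w∈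
    cs , rest≈ ← linComb∈⟨⟩ hs as ws ws∈
    return (map (a *ᶠ_) bs ⊕ cs , (begin
      a *ₗ w +ᴹ linComb as ws                          ≈⟨ +ᴹ-cong (*ₗ-congˡ w≈) rest≈ ⟩
      a *ₗ linComb bs hs +ᴹ linComb cs hs              ≈⟨ +ᴹ-congʳ (≈ᴹ-sym (linComb-scale a bs hs)) ⟩
      linComb (map (a *ᶠ_) bs) hs +ᴹ linComb cs hs     ≈⟨ ≈ᴹ-sym (linComb-⊕ (map (a *ᶠ_) bs) cs hs) ⟩
      linComb (map (a *ᶠ_) bs ⊕ cs) hs                 ∎))

  ⟨⟩-mono : ∀ {gs hs} → All ⟨ hs ⟩ gs → ⟨ gs ⟩ ⊆ ⟨ hs ⟩
  ⟨⟩-mono {gs} {hs} gs⊆ x∈ = do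
    as , x≈ ← x∈
    ⟨⟩-resp hs (≈ᴹ-sym x≈) (linComb∈⟨⟩ hs as gs gs⊆)

  ⟨⟩-⊆ : ∀ {gs hs} → (∀ {x} → x ∈ gs → x ∈ hs) → ⟨ gs ⟩ ⊆ ⟨ hs ⟩
  ⟨⟩-⊆ gs⊆hs = ⟨⟩-mono (All.tabulate λ x∈gs → return (Span-∈ (gs⊆hs x∈gs)))

module Independence {c ℓ m ℓm} {F : CommutativeRing c ℓ} (isField : IsField F) (M : Module F m ℓm) where

  open CommutativeRing F using (0#; 1#; *-comm; *-assoc; *-congˡ; *-identityʳ; -‿cong; -‿inverseʳ; ring)
    renaming (Carrier to K; _≈_ to _≈ᶠ_; _+_ to _+ᶠ_; _*_ to _*ᶠ_; -_ to -ᶠ_;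
              sym to symᶠ; trans to transᶠ; +-congˡ to +ᶠ-congˡ)
  open IsField isField
  open import Algebra.Properties.Ring ring using (-‿distribˡ-*)
  open Module M renaming (Carrierᴹ to V)
  open CommutativeSemigroupProperties (CommutativeMonoid.commutativeSemigroup +ᴹ-commutativeMonoid)
    using (interchange; x∙yz≈xz∙y)
  open import Relation.Binary.Reasoning.Setoid ≈ᴹ-setoid
  open LinearCombinations M public

  -- Only ¬¬ (a ≈ 0) for each coefficient: this is what survives adjoining a vector
  -- outside the span (Independent-∷), where one cannot decide whether a ≈ 0.
  Independent : List V → Set (c ⊔ ℓ ⊔ ℓm)
  Independent ws = ∀ as → length as ≡ length ws → linComb as ws ≈ᴹ 0ᴹ → All (λ a → ¬ ¬ a ≈ᶠ 0#) as

  Independent-[] : Independent []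
  Independent-[] [] _ _ = []

  Independent-resp : ∀ {xs ys} → Pointwise _≈ᴹ_ xs ys → Independent xs → Independent ys
  Independent-resp xs≈ys ind as |as| as·ys≈0 =
    ind as (trans |as| (sym (Pointwise-length xs≈ys))) (≈ᴹ-trans (linComb-cong as xs≈ys) as·ys≈0)

  Independent⇒head≉0 : ∀ {v vs} → Independent (v ∷ vs) → ¬ v ≈ᴹ 0ᴹ
  Independent⇒head≉0 {v} {vs} ind v≈0
    with ¬¬1≈0 ∷ _ ← ind (1# ∷ replicate (length vs) 0#) (cong suc (List.length-replicate (length vs)))
                        (≈ᴹ-trans (+ᴹ-cong (≈ᴹ-trans (*ₗ-congˡ v≈0) (*ₗ-zeroʳ 1#)) (linComb-zeros (length vs) vs))
                                  (+ᴹ-identityˡ 0ᴹ))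
    = ¬¬1≈0 λ 1≈0 → 0≉1 (symᶠ 1≈0)

  inv : (a : K) → ¬ a ≈ᶠ 0# → K
  inv a a≉0 = proj₁ (inverse a a≉0)

  inv-inverseˡ : ∀ a a≉0 → inv a a≉0 *ᶠ a ≈ᶠ 1#
  inv-inverseˡ a a≉0 = transᶠ (*-comm _ a) (proj₂ (inverse a a≉0))

  isolate : ∀ {a x y} (a≉0 : ¬ a ≈ᶠ 0#) → a *ₗ x +ᴹ y ≈ᴹ 0ᴹ → x ≈ᴹ (-ᶠ inv a a≉0) *ₗ y
  isolate {a} {x} {y} a≉0 ax+y≈0 = begin
    x                                ≈⟨ ≈ᴹ-sym (*ₗ-identityˡ x) ⟩
    1# *ₗ x                          ≈⟨ *ₗ-congʳ (symᶠ (inv-inverseˡ a a≉0)) ⟩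
    (κ *ᶠ a) *ₗ x                    ≈⟨ *ₗ-assoc κ a x ⟩
    κ *ₗ a *ₗ x                      ≈⟨ ≈ᴹ-sym (+ᴹ-identityʳ _) ⟩
    κ *ₗ a *ₗ x +ᴹ 0ᴹ                ≈⟨ +ᴹ-congˡ (≈ᴹ-sym κy-κy≈0) ⟩
    κ *ₗ a *ₗ x +ᴹ (κ *ₗ y +ᴹ -κ *ₗ y) ≈⟨ ≈ᴹ-sym (+ᴹ-assoc _ _ _) ⟩
    (κ *ₗ a *ₗ x +ᴹ κ *ₗ y) +ᴹ -κ *ₗ y ≈⟨ +ᴹ-congʳ (≈ᴹ-sym (*ₗ-distribˡ κ _ _)) ⟩
    κ *ₗ (a *ₗ x +ᴹ y) +ᴹ -κ *ₗ y    ≈⟨ +ᴹ-congʳ (≈ᴹ-trans (*ₗ-congˡ ax+y≈0) (*ₗ-zeroʳ κ)) ⟩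
    0ᴹ +ᴹ -κ *ₗ y                    ≈⟨ +ᴹ-identityˡ _ ⟩
    -κ *ₗ y                          ∎
    where
    κ = inv a a≉0
    -κ = -ᶠ κ
    κy-κy≈0 : κ *ₗ y +ᴹ -κ *ₗ y ≈ᴹ 0ᴹ
    κy-κy≈0 = ≈ᴹ-trans (≈ᴹ-sym (*ₗ-distribʳ y κ -κ)) (≈ᴹ-trans (*ₗ-congʳ (-‿inverseʳ κ)) (*ₗ-zeroˡ y))

  Independent-∷ : ∀ {x D} → Independent D → ¬ Span D x → Independent (x ∷ D)
  Independent-∷ {x} {D} ind x∉D (a ∷ as) |as| ax+as·D≈0 =
    ¬¬a≈0 ∷ All.tabulate λ b∈as → ¬¬a≈0 >>= λ a≈0 → All.lookup (rest≈0 a≈0) b∈as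
    where
    ¬¬a≈0 : ¬ ¬ a ≈ᶠ 0#
    ¬¬a≈0 a≉0 = x∉D (map ((-ᶠ inv a a≉0) *ᶠ_) as ,
      ≈ᴹ-trans (isolate a≉0 ax+as·D≈0) (≈ᴹ-sym (linComb-scale _ as D)))
    rest≈0 : a ≈ᶠ 0# → All (λ b → ¬ ¬ b ≈ᶠ 0#) as
    rest≈0 a≈0 = ind as (ℕ.suc-injective |as|) (begin
      linComb as D                  ≈⟨ ≈ᴹ-sym (+ᴹ-identityˡ _) ⟩
      0ᴹ +ᴹ linComb as D            ≈⟨ +ᴹ-congʳ (≈ᴹ-sym (≈ᴹ-trans (*ₗ-congʳ a≈0) (*ₗ-zeroˡ x))) ⟩
      a *ₗ x +ᴹ linComb as D        ≈⟨ ax+as·D≈0 ⟩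
      0ᴹ                            ∎)

  -- A relation as among the sheared vectors is a relation among the original ones,
  -- with coefficient dot as (map f (pre ++ post)) on U r.
  Independent-shear : (U : X → V) (f : X → K) → ∀ pre r post →
    Independent (map U (pre ++ r ∷ post)) →
    Independent (map (λ s → U s +ᴹ f s *ₗ U r) (pre ++ post))
  Independent-shear U f pre r post ind as |as| as·sheared≈0 =
    subst (All _) (List.take++drop≡id (length pre) as)
      (All.++⁺ (All.++⁻ˡ as₁ all≈0) (All.tail (All.++⁻ʳ as₁ all≈0)))
    where
    |as|′ : length as ≡ length pre + length post
    |as|′ = trans |as| (trans (List.length-map _ (pre ++ post)) (List.length-++ pre))
    as₁ = take (length pre) as
    as₂ = drop (length pre) as
    |as₁| = proj₁ (take-drop-length (length pre) as |as|′)
    |as₂| = proj₂ (take-drop-length (length pre) as |as|′)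
    |as₁|′ : length as₁ ≡ length (map U pre)
    |as₁|′ = trans |as₁| (sym (List.length-map U pre))
    d = dot as (map f (pre ++ post))
    all≈0 : All (λ a → ¬ ¬ a ≈ᶠ 0#) (as₁ ++ d ∷ as₂)
    all≈0 = ind (as₁ ++ d ∷ as₂)
      (trans (List.length-++ as₁) (trans (cong₂ _+_ |as₁| (cong suc |as₂|))
        (sym (trans (List.length-map U (pre ++ r ∷ post)) (List.length-++ pre)))))
      (begin
        linComb (as₁ ++ d ∷ as₂) (map U (pre ++ r ∷ post))
          ≡⟨ cong (linComb (as₁ ++ d ∷ as₂)) (List.map-++ U pre (r ∷ post)) ⟩
        linComb (as₁ ++ d ∷ as₂) (map U pre ++ U r ∷ map U post)
          ≈⟨ linComb-++ as₁ (d ∷ as₂) (map U pre) (U r ∷ map U post) |as₁|′ ⟩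
        linComb as₁ (map U pre) +ᴹ (d *ₗ U r +ᴹ linComb as₂ (map U post))
          ≈⟨ x∙yz≈xz∙y _ _ _ ⟩
        (linComb as₁ (map U pre) +ᴹ linComb as₂ (map U post)) +ᴹ d *ₗ U r
          ≈⟨ +ᴹ-congʳ (≈ᴹ-sym (linComb-++ as₁ as₂ (map U pre) (map U post) |as₁|′)) ⟩
        linComb (as₁ ++ as₂) (map U pre ++ map U post) +ᴹ d *ₗ U r
          ≡⟨ cong (λ (bs , vs) → linComb bs vs +ᴹ d *ₗ U r)
               (cong₂ _,_ (List.take++drop≡id (length pre) as) (sym (List.map-++ U pre post))) ⟩
        linComb as (map U (pre ++ post)) +ᴹ d *ₗ U r
          ≈⟨ ≈ᴹ-sym (linComb-shear U f (U r) as (pre ++ post)) ⟩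
        linComb as (map (λ s → U s +ᴹ f s *ₗ U r) (pre ++ post))
          ≈⟨ as·sheared≈0 ⟩
        0ᴹ ∎)

  eliminate-leading : ∀ {c} s r w ws → head₀ s +ᶠ c *ᶠ head₀ r ≈ᶠ 0# →
    linComb s (w ∷ ws) +ᴹ c *ₗ linComb r (w ∷ ws) ≈ᴹ linComb (tail₀ s ⊕ map (c *ᶠ_) (tail₀ r)) ws
  eliminate-leading {c} s r w ws s₀+cr₀≈0 = begin
    linComb s (w ∷ ws) +ᴹ c *ₗ linComb r (w ∷ ws)
      ≈⟨ +ᴹ-cong (linComb-∷ s w ws) (≈ᴹ-trans (*ₗ-congˡ (linComb-∷ r w ws)) (*ₗ-distribˡ c _ _)) ⟩
    (s₀ *ₗ w +ᴹ linComb s′ ws) +ᴹ (c *ₗ r₀ *ₗ w +ᴹ c *ₗ linComb r′ ws)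
      ≈⟨ interchange _ _ _ _ ⟩
    (s₀ *ₗ w +ᴹ c *ₗ r₀ *ₗ w) +ᴹ (linComb s′ ws +ᴹ c *ₗ linComb r′ ws)
      ≈⟨ +ᴹ-congʳ (≈ᴹ-trans (+ᴹ-congˡ (≈ᴹ-sym (*ₗ-assoc c r₀ w))) (≈ᴹ-sym (*ₗ-distribʳ w s₀ _))) ⟩
    (s₀ +ᶠ c *ᶠ r₀) *ₗ w +ᴹ (linComb s′ ws +ᴹ c *ₗ linComb r′ ws)
      ≈⟨ +ᴹ-congʳ (≈ᴹ-trans (*ₗ-congʳ s₀+cr₀≈0) (*ₗ-zeroˡ w)) ⟩
    0ᴹ +ᴹ (linComb s′ ws +ᴹ c *ₗ linComb r′ ws)
      ≈⟨ +ᴹ-identityˡ _ ⟩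
    linComb s′ ws +ᴹ c *ₗ linComb r′ ws
      ≈⟨ ≈ᴹ-sym (≈ᴹ-trans (linComb-⊕ s′ _ ws) (+ᴹ-congˡ (linComb-scale c r′ ws))) ⟩
    linComb (s′ ⊕ map (c *ᶠ_) r′) ws ∎
    where
    s₀ = head₀ s
    r₀ = head₀ r
    s′ = tail₀ s
    r′ = tail₀ r

  Independent-dropColumn : ∀ w ws rows → All (λ r → head₀ r ≈ᶠ 0#) rows →
    Independent (map (λ r → linComb r (w ∷ ws)) rows) →
    Independent (map (λ r → linComb r ws) (map tail₀ rows))
  Independent-dropColumn w ws rows column≈0 ind =
    subst Independent (List.map-∘ rows)
      (Independent-resp (Pointwise-map (λ r → linComb r (w ∷ ws)) (λ r → linComb (tail₀ r) ws)
                                       (All.map (λ {r} → drop≈ r) column≈0))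
                        ind)
    where
    drop≈ : ∀ r → head₀ r ≈ᶠ 0# → linComb r (w ∷ ws) ≈ᴹ linComb (tail₀ r) ws
    drop≈ r r₀≈0 = ≈ᴹ-trans (linComb-∷ r w ws)
      (≈ᴹ-trans (+ᴹ-congʳ (≈ᴹ-trans (*ₗ-congʳ r₀≈0) (*ₗ-zeroˡ w))) (+ᴹ-identityˡ _))

  pivot-multiplier : ∀ r → ¬ head₀ r ≈ᶠ 0# → List K → K
  pivot-multiplier r r₀≉0 s = -ᶠ (head₀ s *ᶠ inv (head₀ r) r₀≉0)

  pivot-multiplier-cancels : ∀ r r₀≉0 s → head₀ s +ᶠ pivot-multiplier r r₀≉0 s *ᶠ head₀ r ≈ᶠ 0#
  pivot-multiplier-cancels r r₀≉0 s = transᶠ (+ᶠ-congˡ (transᶠ (symᶠ (-‿distribˡ-* (s₀ *ᶠ κ) r₀))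
      (-‿cong (transᶠ (*-assoc s₀ κ r₀) (transᶠ (*-congˡ (inv-inverseˡ r₀ r₀≉0)) (*-identityʳ s₀))))))
    (-‿inverseʳ s₀)
    where
    s₀ = head₀ s
    r₀ = head₀ r
    κ = inv r₀ r₀≉0

  eliminate : ∀ r → ¬ head₀ r ≈ᶠ 0# → List K → List K
  eliminate r r₀≉0 s = tail₀ s ⊕ map (pivot-multiplier r r₀≉0 s *ᶠ_) (tail₀ r)

  Independent-eliminate : ∀ w ws pre r post (r₀≉0 : ¬ head₀ r ≈ᶠ 0#) →
    Independent (map (λ s → linComb s (w ∷ ws)) (pre ++ r ∷ post)) →
    Independent (map (λ s → linComb s ws) (map (eliminate r r₀≉0) (pre ++ post)))
  Independent-eliminate w ws pre r post r₀≉0 ind =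
    subst Independent (List.map-∘ (pre ++ post))
      (Independent-resp
        (Pointwise-map _ _ (All.universal (λ s → eliminate-leading s r w ws (pivot-multiplier-cancels r r₀≉0 s)) _))
        (Independent-shear (λ s → linComb s (w ∷ ws)) (pivot-multiplier r r₀≉0) pre r post ind))

  steinitz-rows : ∀ ws rows → Independent (map (λ r → linComb r ws) rows) → length rows ≤ length ws
  steinitz-rows []       []      _   = z≤n
  steinitz-rows []       (r ∷ _) ind = ⊥-elim (Independent⇒head≉0 ind (linComb-[]ʳ r))
  steinitz-rows (w ∷ ws) rows    ind = ≤-stable (¬¬-map bound (¬¬-All-or-counterexample rows))
    where
    bound : All (λ r → head₀ r ≈ᶠ 0#) rows ⊎
            Σ (List (List K) × List K × List (List K)) (λ (pre , r , post) → rows ≡ pre ++ r ∷ post × ¬ head₀ r ≈ᶠ 0#) →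
            length rows ≤ suc (length ws)
    bound (inj₁ column≈0) = ℕ.m≤n⇒m≤1+n (subst (_≤ length ws) (List.length-map tail₀ rows)
      (steinitz-rows ws (map tail₀ rows) (Independent-dropColumn w ws rows column≈0 ind)))
    bound (inj₂ ((pre , r , post) , rows≡ , r₀≉0)) = subst (_≤ suc (length ws)) (sym |rows|)
      (s≤s (subst (_≤ length ws) (trans (List.length-map _ (pre ++ post)) (List.length-++ pre))
        (steinitz-rows ws _ (Independent-eliminate w ws pre r post r₀≉0
          (subst (λ rs → Independent (map (λ s → linComb s (w ∷ ws)) rs)) rows≡ ind)))))
      where
      |rows| : length rows ≡ suc (length pre + length post)
      |rows| = trans (cong length rows≡) (trans (List.length-++ pre) (ℕ.+-suc (length pre) (length post)))

  coefficientRows : ∀ {gs us} → All (Span gs) us →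
    Σ (List (List K)) λ rows → Pointwise _≈ᴹ_ us (map (λ r → linComb r gs) rows)
  coefficientRows []                  = [] , []
  coefficientRows ((as , u≈) ∷ spans) = let rows , us≈ = coefficientRows spans in as ∷ rows , u≈ ∷ us≈

  steinitz : ∀ {us gs} → Independent us → All ⟨ gs ⟩ us → length us ≤ length gs
  steinitz {us} {gs} ind us∈ = ≤-stable (¬¬-map bound (¬¬-All us∈))
    where
    bound : All (Span gs) us → length us ≤ length gs
    bound spans = let rows , us≈ = coefficientRows spans in
      subst (_≤ length gs) (sym (trans (Pointwise-length us≈) (List.length-map _ rows)))
        (steinitz-rows gs rows (Independent-resp us≈ ind))

  module _ {u} {U : Pred V u} {gs : List V} (U⊆gs : U ⊆ ⟨ gs ⟩) where

    Extension : List V → Set (c ⊔ ℓ ⊔ m ⊔ ℓm ⊔ u)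
    Extension D = Σ (List V) λ E → All U E × Independent (E ++ D) × U ⊆ ⟨ E ++ D ⟩

    Extension-∷ : ∀ {x D} → U x → Extension (x ∷ D) → Extension D
    Extension-∷ {x} {D} x∈U (E , E∈U , indE , U⊆E) =
      E ++ x ∷ [] , All.++⁺ E∈U (x∈U ∷ []) , subst Independent E++x++D≡ indE , subst (λ L → U ⊆ ⟨ L ⟩) E++x++D≡ U⊆E
      where
      E++x++D≡ : E ++ x ∷ D ≡ (E ++ x ∷ []) ++ D
      E++x++D≡ = sym (List.++-assoc E (x ∷ []) D)

    ¬⊆⟨⟩⇒outside : ∀ {D} → ¬ U ⊆ ⟨ D ⟩ → ¬ ¬ Σ V λ x → U x × ¬ Span D x
    ¬⊆⟨⟩⇒outside U⊈D ¬outside = U⊈D λ x∈U x∉D → ¬outside (_ , x∈U , x∉D)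

    -- The fuel counts how many more vectors may still be adjoined; Steinitz
    -- bounds every independent list in U by length gs, so it never runs out.
    extend-to-basis : ∀ {D} → All U D → Independent D → ¬ ¬ Extension D
    extend-to-basis {D} = go (suc (length gs)) (ℕ.m≤n+m (suc (length gs)) (length D))
      where
      go : ∀ fuel {D} → length gs < length D + fuel → All U D → Independent D → ¬ ¬ Extension D
      go fuel {D} bound D∈U indD = ¬¬-excluded-middle >>= λ where
          (yes U⊆D) → return ([] , [] , indD , U⊆D)
          (no U⊈D)  → do
            x , x∈U , x∉D ← ¬⊆⟨⟩⇒outside U⊈D
            adjoin x∈U x∉D fuel bound
        where
        adjoin : ∀ {x} → U x → ¬ Span D x → ∀ fuel → length gs < length D + fuel → ¬ ¬ Extension D
        adjoin _ _ zero bound =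
          ⊥-elim (ℕ.<⇒≱ (subst (length gs <_) (ℕ.+-identityʳ (length D)) bound)
                        (steinitz {gs = gs} indD (All.map U⊆gs D∈U)))
        adjoin x∈U x∉D (suc fuel) bound =
          ¬¬-map (Extension-∷ x∈U) (go fuel (subst (length gs <_) (ℕ.+-suc (length D) fuel) bound)
                                       (x∈U ∷ D∈U) (Independent-∷ indD x∉D))

    Basis : Set (c ⊔ ℓ ⊔ m ⊔ ℓm ⊔ u)
    Basis = Σ (List V) λ D → All U D × Independent D × U ⊆ ⟨ D ⟩

    basis-exists : ¬ ¬ Basis
    basis-exists = ¬¬-map fromExtension (extend-to-basis [] Independent-[])
      where
      fromExtension : Extension [] → Basis
      fromExtension (D , D∈U , indD , U⊆D) = D , D∈U ,
        subst Independent (List.++-identityʳ D) indD , subst (λ L → U ⊆ ⟨ L ⟩) (List.++-identityʳ D) U⊆D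

module Bases {c ℓ m ℓm} {F : CommutativeRing c ℓ} (isField : IsField F) (M : Module F m ℓm) where

  open CommutativeRing F using (0#) renaming (Carrier to K; _≈_ to _≈ᶠ_)
  open Module M renaming (Carrierᴹ to V)
  open Independence isField M public
  open LinearAlgebra M using (Subset; lincomb; LinearlyIndependent; HasDim; SpanOf)

  lincomb≡linComb : ∀ {d} (a : Fin d → K) (b : Fin d → V) → lincomb a b ≡ linComb (tabulate a) (tabulate b)
  lincomb≡linComb {zero}  a b = refl
  lincomb≡linComb {suc d} a b = cong (a zero *ₗ b zero +ᴹ_) (lincomb≡linComb (a ∘ suc) (b ∘ suc))

  lookup₀ : ∀ {d} → List K → Fin d → K
  lookup₀ []       _       = 0#
  lookup₀ (a ∷ _)  zero    = a
  lookup₀ (_ ∷ as) (suc i) = lookup₀ as i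

  linComb≡lincomb-lookup₀ : ∀ {d} as (b : Fin d → V) → length as ≡ d → linComb as (tabulate b) ≡ lincomb (lookup₀ as) b
  linComb≡lincomb-lookup₀ {zero}  []       b _     = refl
  linComb≡lincomb-lookup₀ {suc d} (a ∷ as) b |as| =
    cong (a *ₗ b zero +ᴹ_) (linComb≡lincomb-lookup₀ as (b ∘ suc) (ℕ.suc-injective |as|))

  lookup₀≈0⇒All≈0 : ∀ {d} as → length as ≡ d → (∀ (i : Fin d) → lookup₀ as i ≈ᶠ 0#) → All (λ a → ¬ ¬ a ≈ᶠ 0#) as
  lookup₀≈0⇒All≈0 {zero}  []       _    _     = []
  lookup₀≈0⇒All≈0 {suc d} (a ∷ as) |as| lookup₀≈0 =
    return (lookup₀≈0 zero) ∷ lookup₀≈0⇒All≈0 as (ℕ.suc-injective |as|) (lookup₀≈0 ∘ suc)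

  LinearlyIndependent⇒Independent : ∀ {d} {b : Fin d → V} → LinearlyIndependent b → Independent (tabulate b)
  LinearlyIndependent⇒Independent {b = b} indep as |as| as·b≈0 = lookup₀≈0⇒All≈0 as |as|′
    (indep (lookup₀ as) (≈ᴹ-trans (≈ᴹ-reflexive (sym (linComb≡lincomb-lookup₀ as b |as|′))) as·b≈0))
    where |as|′ = trans |as| (List.length-tabulate b)

  HasDim⇒basis : ∀ {U d} → HasDim U d →
    Σ (List V) λ bs → length bs ≡ d × All U bs × Independent bs × U ⊆ ⟨ bs ⟩
  HasDim⇒basis (b , b∈U , indep , spans) =
    tabulate b , List.length-tabulate b , All.tabulate⁺ b∈U , LinearlyIndependent⇒Independent indep ,
    λ x∈U → let a , x≈ = spans x∈U in return (tabulate a , ≈ᴹ-trans x≈ (≈ᴹ-reflexive (lincomb≡linComb a b)))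

  dim≤length : ∀ {U d ws} → HasDim U d → U ⊆ ⟨ ws ⟩ → d ≤ length ws
  dim≤length hasDim U⊆ws with bs , |bs| , bs∈U , indBs , _ ← HasDim⇒basis hasDim =
    subst (_≤ _) |bs| (steinitz indBs (All.map U⊆ws bs∈U))

  length≤dim : ∀ {U d us} → HasDim U d → Independent us → All U us → length us ≤ d
  length≤dim hasDim indUs us∈U with bs , |bs| , _ , _ , U⊆bs ← HasDim⇒basis hasDim =
    subst (_ ≤_) |bs| (steinitz indUs (All.map U⊆bs us∈U))

  SpanOf⊆⟨⟩ : ∀ {I : Set} {U : I → Subset} {ws} → (∀ i → U i ⊆ ⟨ ws ⟩) → SpanOf U ⊆ ⟨ ws ⟩
  SpanOf⊆⟨⟩ {ws = ws} U⊆ws (d , a , w , w∈ , x≈) =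
    ⟨⟩-resp ws (≈ᴹ-sym x≈) (subst ⟨ ws ⟩ (sym (lincomb≡linComb a w))
      (linComb∈⟨⟩ ws (tabulate a) (tabulate w) (All.tabulate⁺ λ l → let i , wₗ∈ = w∈ l in U⊆ws i wₗ∈)))

module Construction {c ℓ m ℓm} {F : CommutativeRing c ℓ} (isField : IsField F) (M : Module F m ℓm)
  (k n : ℕ) (π : Fin n → LinearAlgebra.Subset M) (dim-π : ∀ i → LinearAlgebra.HasDim M (π i) k) where

  open Module M using () renaming (Carrierᴹ to V)
  open Bases isField M
  open LinearAlgebra M using (Subset; HasDim; SpanOf) renaming (_∩_ to _∩ᴸ_)
  open CommutativeSemigroupProperties ℕ.+-commutativeSemigroup using () renaming (interchange to +-interchange)

  S I : Subset
  S = SpanOf π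
  I = SpanOf {Σ (Fin n × Fin n) (λ p → proj₁ p <ᶠ proj₂ p)} (λ p → π (proj₁ (proj₁ p)) ∩ᴸ π (proj₂ (proj₁ p)))

  π-spanned : ∀ i → Σ (List V) λ gs → π i ⊆ ⟨ gs ⟩
  π-spanned i with gs , _ , _ , _ , π⊆gs ← HasDim⇒basis (dim-π i) = gs , π⊆gs

  record Stage (j : ℕ) : Set (c ⊔ ℓ ⊔ m ⊔ ℓm) where
    field
      A B     : List V
      size    : length A + length B ≤ j * k
      A-spans : ∀ i → toℕ i < j → π i ⊆ ⟨ A ⟩
      B-spans : ∀ i i' → toℕ i < toℕ i' → toℕ i' < j → π i ∩ π i' ⊆ ⟨ B ⟩

  stage₀ : Stage 0
  stage₀ = record { A = [] ; B = [] ; size = z≤n ; A-spans = λ _ () ; B-spans = λ _ _ _ () }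

  nextStage : ∀ {j} → j < n → Stage j → ¬ ¬ Stage (suc j)
  nextStage {j} j<n stage = do
    D , D∈A∩πp , indD , A∩πp⊆D ← basis-exists {U = ⟨ A ⟩ ∩ π p} (π⊆gs ∘ proj₂)
    E , E∈πp , indED , πp⊆ED ← extend-to-basis π⊆gs (All.map proj₂ D∈A∩πp) indD
    return (record
      { A       = A ++ E
      ; B       = B ++ D
      ; size    = size′ (length≤dim (dim-π p) indED (All.++⁺ E∈πp (All.map proj₂ D∈A∩πp)))
      ; A-spans = A-spans′ E D (All.map proj₁ D∈A∩πp) πp⊆ED
      ; B-spans = B-spans′ D A∩πp⊆D
      })
    where
    open Stage stage
    p = fromℕ< j<n
    π⊆gs = proj₂ (π-spanned p)

    toℕ≡j⇒π⊆πp : ∀ {i} → toℕ i ≡ j → π i ⊆ π p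
    toℕ≡j⇒π⊆πp toℕi≡j = subst (λ q → π q _) (toℕ-injective (trans toℕi≡j (sym (toℕ-fromℕ< j<n))))

    size′ : ∀ {E D} → length (E ++ D) ≤ k → length (A ++ E) + length (B ++ D) ≤ suc j * k
    size′ {E} {D} |ED|≤k = begin
      length (A ++ E) + length (B ++ D)         ≡⟨ cong₂ _+_ (List.length-++ A) (List.length-++ B) ⟩
      (length A + length E) + (length B + length D) ≡⟨ +-interchange (length A) _ _ _ ⟩
      (length A + length B) + (length E + length D) ≤⟨ ℕ.+-mono-≤ size (subst (_≤ k) (List.length-++ E) |ED|≤k) ⟩
      j * k + k                                 ≡⟨ ℕ.+-comm (j * k) k ⟩
      suc j * k                                 ∎
      where open ℕ.≤-Reasoning

    A-spans′ : ∀ E D → All ⟨ A ⟩ D → π p ⊆ ⟨ E ++ D ⟩ → ∀ i → toℕ i < suc j → π i ⊆ ⟨ A ++ E ⟩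
    A-spans′ E D D⊆A πp⊆ED i i<1+j with ℕ.m<1+n⇒m<n∨m≡n i<1+j
    ... | inj₁ i<j  = ⟨⟩-⊆ ∈-++⁺ˡ ∘ A-spans i i<j
    ... | inj₂ i≡j =
      ⟨⟩-mono E++D⊆A++E ∘ πp⊆ED ∘ toℕ≡j⇒π⊆πp i≡j
      where
      E++D⊆A++E : All ⟨ A ++ E ⟩ (E ++ D)
      E++D⊆A++E = All.++⁺ (All.tabulate λ x∈E → return (Span-∈ (∈-++⁺ʳ A x∈E))) (All.map (⟨⟩-⊆ ∈-++⁺ˡ) D⊆A)

    B-spans′ : ∀ D → ⟨ A ⟩ ∩ π p ⊆ ⟨ D ⟩ →
      ∀ i i' → toℕ i < toℕ i' → toℕ i' < suc j → π i ∩ π i' ⊆ ⟨ B ++ D ⟩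
    B-spans′ D A∩πp⊆D i i' i<i' i'<1+j with ℕ.m<1+n⇒m<n∨m≡n i'<1+j
    ... | inj₁ i'<j = ⟨⟩-⊆ ∈-++⁺ˡ ∘ B-spans i i' i<i' i'<j
    ... | inj₂ i'≡j = λ (x∈πi , x∈πi') →
      ⟨⟩-⊆ (∈-++⁺ʳ B) (A∩πp⊆D (A-spans i (subst (toℕ i <_) i'≡j i<i') x∈πi , toℕ≡j⇒π⊆πp i'≡j x∈πi'))

  stage : ∀ j → j ≤ n → ¬ ¬ Stage j
  stage zero    _   = return stage₀
  stage (suc j) j<n = stage j (ℕ.<⇒≤ j<n) >>= nextStage j<n

  dim-bound : ∀ {dimS dimI} → HasDim S dimS → HasDim I dimI → dimS + dimI ≤ n * k
  dim-bound {dimS} {dimI} hasDimS hasDimI = ≤-stable (¬¬-map bound (stage n ℕ.≤-refl))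
    where
    bound : Stage n → dimS + dimI ≤ n * k
    bound final = ℕ.≤-trans (ℕ.+-mono-≤
      (dim≤length hasDimS (SpanOf⊆⟨⟩ λ i → A-spans i (toℕ<n i)))
      (dim≤length hasDimI (SpanOf⊆⟨⟩ λ ((i , i') , i<i') → B-spans i i' i<i' (toℕ<n i')))) size
      where open Stage final

theorem1 : {c ℓ m ℓm : Level} (F : CommutativeRing c ℓ) → IsFiniteField F →
    (V : Module F m ℓm) → (k t : ℕ) → t ≤ k → (n : ℕ) → 2 ≤ n →
    (π : Fin n → LinearAlgebra.Subset V) → LinearAlgebra.IsSCID V k t n π →
    (dimS dimI : ℕ) →
    LinearAlgebra.HasDim V (LinearAlgebra.SpanOf V π) dimS →
    LinearAlgebra.HasDim V (LinearAlgebra.SpanOf V {Σ (Fin n × Fin n) (λ p → proj₁ p <ᶠ proj₂ p)} (λ p → LinearAlgebra._∩_ V (π (proj₁ (proj₁ p))) (π (proj₂ (proj₁ p))))) dimI →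
    dimS + dimI ≤ n * k
theorem1 F finite V k t t≤k n 2≤n π scid dimS dimI hasDimS hasDimI =
  Construction.dim-bound (IsFiniteField.isField finite) V k n π (LinearAlgebra.IsSCID.dim-k scid)
    hasDimS hasDimI
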